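{- Let $n\geq 1$ and $m \geq 1$ be integers. Then \[ \frac{1}{(n-1)!}\Big\{\frac{n^{m+n}}{m+n}+\sum_{i=1}^{n}(-1)^{i}\binom{n}{i}\Big[\sum_{j=0}^{n-1}\binom{n-1}{j}(-i)^{n-j-1}\frac{n^{m+j+1}-i^{m+j+1}}{m+j+1}\Big]\Big\} =\sum_{i_{1}+\cdots+i_{n}=m}\binom{m}{i_{1},\dots,i_{n}}\frac{1}{(i_{1}+1)\cdots(i_{n}+1)}, \] where the sum on the right runs over all $n$-tuples of nonnegative integers with $i_1+\cdots+i_n=m$.
   Context: $\binom{m}{i_1,\dots,i_n}=\frac{m!}{i_1!\cdots i_n!}$ is the multinomial coefficient; the convention $0^0=1$ is used. -}

module Defs where

open import Data.Nat as ℕ using (ℕ; zero; suc; _∸_; _≟_)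
open import Data.Nat.Combinatorics using (_C_)
open import Data.Nat.Properties using ()
open import Data.Integer as ℤ using (ℤ; +_)
open import Data.Rational as ℚ using (ℚ; 0ℚ; _+_; _*_)
open import Data.List as L using (List; []; _∷_; map; foldr; concatMap; filter; upTo)
open import Data.Nat.ListAction using (product)
open import Data.Vec as Vec using (Vec; []; _∷_)
open import Relation.Nullary.Decidable using (does)

fact : ℕ → ℕ
fact zero    = 1
fact (suc n) = suc n ℕ.* fact n

-- integer divided by a natural, as a rational; all denominators used below
-- are positive, the zero case is only a totality convention
infixl 7 _//_
_//_ : ℤ → ℕ → ℚ
p // zero  = 0ℚ
p // suc d = p ℚ./ suc d

sumℚ : List ℚ → ℚ
sumℚ = foldr _+_ 0ℚ

Σ[_to_] : ℕ → ℕ → (ℕ → ℚ) → ℚ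
Σ[ a to b ] f = sumℚ (map (λ k → f (a ℕ.+ k)) (upTo (suc b ∸ a)))

binom : ℕ → ℕ → ℚ
binom n k = (+ (n C k)) // 1

tuples : (n m : ℕ) → List (Vec ℕ n)
tuples zero    m = [] ∷ []
tuples (suc n) m = concatMap (λ k → map (k ∷_) (tuples n m)) (upTo (suc m))

compositions : (n m : ℕ) → List (Vec ℕ n)
compositions n m = filter (λ v → Vec.sum v ≟ m) (tuples n m)

multinomial : (m : ℕ) → {n : ℕ} → Vec ℕ n → ℚ
multinomial m v = (+ fact m) // product (Vec.toList (Vec.map fact v))

lhs : ℕ → ℕ → ℚ
lhs n m = ((+ 1) // fact (n ∸ 1)) *
  ( ((+ (n ℕ.^ (m ℕ.+ n))) // (m ℕ.+ n))
  + Σ[ 1 to n ] (λ i →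
      ((ℤ.- (+ 1)) ℤ.^ i // 1) * binom n i *
      Σ[ 0 to n ∸ 1 ] (λ j →
        binom (n ∸ 1) j
        * ((ℤ.- (+ i)) ℤ.^ (n ∸ j ∸ 1) // 1)
        * ((+ (n ℕ.^ (m ℕ.+ j ℕ.+ 1)) ℤ.- + (i ℕ.^ (m ℕ.+ j ℕ.+ 1))) // (m ℕ.+ j ℕ.+ 1)))))

rhs : ℕ → ℕ → ℚ
rhs n m = sumℚ (map (λ v → multinomial m v * ((+ 1) // product (Vec.toList (Vec.map suc v))))
                    (compositions n m))

module Submission where

-- Write Sₙ(M) = Σₗ (-1)ⁿ⁻ˡ C(n,l) lᴹ = Δⁿ[xᴹ](0), the number of surjections from an M-set onto an
-- n-set. Both sides equal m! Sₙ(m+n)/(m+n)!.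
-- Right: the sum is m! times the coefficient of xᵐ in ((eˣ - 1)/x)ⁿ; splitting off the first part of
-- a composition gives a recursion in n that matches Sₙ₊₁(M) = Σ_{j<M} C(M,j) Sₙ(j).
-- Left: the first term is the missing i = 0 summand, so the braces are Σᵢ (-1)ⁱ C(n,i) A(i). The
-- bracket A(i) is a polynomial of degree < n in i plus c·iᵐ⁺ⁿ, and Δⁿ kills the polynomial. The
-- coefficient c is, up to sign, the beta integral Σⱼ (-1)ʲ C(n-1,j)/(m+j+1) = (n-1)! m!/(m+n)!.

open import Defs
open import Algebra.Bundles using (CommutativeRing)
open import Data.Bool using (Bool; true; false; if_then_else_)
open import Data.Integer as ℤ using (ℤ)
import Data.Integer.Properties as ℤₚ
open import Data.List using (List; []; _∷_; map; applyUpTo; concatMap; filter; _++_; upTo)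
import Data.List.Properties as Listₚ
open import Data.Nat as ℕ using (ℕ; zero; suc; _∸_; _≟_; _≤_; _<_; _≥_; z≤n; s≤s; _!)
open import Data.Nat.Combinatorics
  using (_C_; nCk+nC[k+1]≡[n+1]C[k+1]; k>n⇒nCk≡0; nCn≡1; nCk≡n!/k![n-k]!; k![n∸k]!∣n!)
open import Data.Nat.DivMod using (m/n*n≡m)
open import Data.Nat.ListAction using (product)
import Data.Nat.Properties as ℕₚ
open import Data.Nat.Tactic.RingSolver using (solve-∀)
open import Data.Rational as ℚ using (ℚ; 0ℚ; 1ℚ; _+_; _*_; -_; _-_)
import Data.Rational.Properties as ℚₚ
open import Data.Rational.Solver using (module +-*-Solver)
import Data.Rational.Unnormalised as ℚᵘ
import Data.Rational.Unnormalised.Properties as ℚᵘₚ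
open import Data.Vec as Vec using (Vec; []; _∷_)
open import Relation.Binary.PropositionalEquality
open import Relation.Nullary.Decidable using (Dec; does; yes; no; dec-true; dec-false)
open import Relation.Nullary.Negation using (contradiction)

open import Algebra.Properties.Semiring.Exp (CommutativeRing.semiring ℚₚ.+-*-commutativeRing)
  using (_^_; ^-homo-*)
open +-*-Solver

toℚ : ℕ → ℚ
toℚ n = ℤ.+ n // 1

infix 8 1/_
1/_ : ℕ → ℚ
1/ n = ℤ.+ 1 // n

//-cross : ∀ x y b d → x ℤ.* ℤ.+ suc d ≡ y ℤ.* ℤ.+ suc b → x // suc b ≡ y // suc d
//-cross x y b d eq = ℚₚ.toℚᵘ-injective (begin
  ℚ.toℚᵘ (x // suc b) ≈⟨ ℚₚ.toℚᵘ-fromℚᵘ (ℚᵘ.mkℚᵘ x b) ⟩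
  ℚᵘ.mkℚᵘ x b          ≈⟨ ℚᵘ.*≡* eq ⟩
  ℚᵘ.mkℚᵘ y d          ≈⟨ ℚₚ.toℚᵘ-fromℚᵘ (ℚᵘ.mkℚᵘ y d) ⟨
  ℚ.toℚᵘ (y // suc d) ∎)
  where open ℚᵘₚ.≃-Reasoning

//-* : ∀ x y b d → (x // b) * (y // d) ≡ (x ℤ.* y) // (b ℕ.* d)
//-* x y zero    d       = ℚₚ.*-zeroˡ (y // d)
//-* x y (suc b) zero    rewrite ℕₚ.*-zeroʳ b = ℚₚ.*-zeroʳ (x // suc b)
//-* x y (suc b) (suc d) = ℚₚ.toℚᵘ-injective (begin
  ℚ.toℚᵘ ((x // suc b) * (y // suc d))           ≈⟨ ℚₚ.toℚᵘ-homo-* (x // suc b) (y // suc d) ⟩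
  ℚ.toℚᵘ (x // suc b) ℚᵘ.* ℚ.toℚᵘ (y // suc d)  ≈⟨ ℚᵘₚ.*-cong (ℚₚ.toℚᵘ-fromℚᵘ (ℚᵘ.mkℚᵘ x b))
                                                                 (ℚₚ.toℚᵘ-fromℚᵘ (ℚᵘ.mkℚᵘ y d)) ⟩
  ℚᵘ.mkℚᵘ x b ℚᵘ.* ℚᵘ.mkℚᵘ y d                  ≈⟨ ℚₚ.toℚᵘ-fromℚᵘ _ ⟨
  ℚ.toℚᵘ ((x ℤ.* y) // (suc b ℕ.* suc d))       ∎)
  where open ℚᵘₚ.≃-Reasoning

//1-+ : ∀ x y → x // 1 + y // 1 ≡ (x ℤ.+ y) // 1
//1-+ x y = ℚₚ.toℚᵘ-injective (begin
  ℚ.toℚᵘ (x // 1 + y // 1)                ≈⟨ ℚₚ.toℚᵘ-homo-+ (x // 1) (y // 1) ⟩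
  ℚ.toℚᵘ (x // 1) ℚᵘ.+ ℚ.toℚᵘ (y // 1)  ≈⟨ ℚᵘₚ.+-cong (ℚₚ.toℚᵘ-fromℚᵘ (ℚᵘ.mkℚᵘ x 0))
                                                        (ℚₚ.toℚᵘ-fromℚᵘ (ℚᵘ.mkℚᵘ y 0)) ⟩
  ℚᵘ.mkℚᵘ x 0 ℚᵘ.+ ℚᵘ.mkℚᵘ y 0          ≈⟨ ℚᵘ.*≡* cross ⟩
  ℚᵘ.mkℚᵘ (x ℤ.+ y) 0                    ≈⟨ ℚₚ.toℚᵘ-fromℚᵘ _ ⟨
  ℚ.toℚᵘ ((x ℤ.+ y) // 1)                ∎)
  where
  open ℚᵘₚ.≃-Reasoning
  cross : (x ℤ.* ℤ.+ 1 ℤ.+ y ℤ.* ℤ.+ 1) ℤ.* ℤ.+ 1 ≡ (x ℤ.+ y) ℤ.* ℤ.+ 1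
  cross rewrite ℤₚ.*-identityʳ x | ℤₚ.*-identityʳ y = refl

//1-neg : ∀ x → (ℤ.- x) // 1 ≡ - (x // 1)
//1-neg x = ℚₚ.toℚᵘ-injective (begin
  ℚ.toℚᵘ ((ℤ.- x) // 1)     ≈⟨ ℚₚ.toℚᵘ-fromℚᵘ _ ⟩
  ℚᵘ.- ℚᵘ.mkℚᵘ x 0          ≈⟨ ℚᵘₚ.-‿cong (ℚₚ.toℚᵘ-fromℚᵘ (ℚᵘ.mkℚᵘ x 0)) ⟨
  ℚᵘ.- ℚ.toℚᵘ (x // 1)      ≈⟨ ℚₚ.toℚᵘ-homo‿- (x // 1) ⟨
  ℚ.toℚᵘ (- (x // 1))       ∎)
  where open ℚᵘₚ.≃-Reasoning

//1-^ : ∀ x k → (x ℤ.^ k) // 1 ≡ (x // 1) ^ k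
//1-^ x zero    = refl
//1-^ x (suc k) = trans (sym (//-* x (x ℤ.^ k) 1 1)) (cong (x // 1 *_) (//1-^ x k))

//≡*1/ : ∀ x b → x // b ≡ x // 1 * 1/ b
//≡*1/ x b = sym (trans (//-* x (ℤ.+ 1) 1 b) (cong₂ _//_ (ℤₚ.*-identityʳ x) (ℕₚ.*-identityˡ b)))

toℚ-+ : ∀ a b → toℚ (a ℕ.+ b) ≡ toℚ a + toℚ b
toℚ-+ a b = trans (cong (_// 1) (ℤₚ.pos-+ a b)) (sym (//1-+ (ℤ.+ a) (ℤ.+ b)))

toℚ-* : ∀ a b → toℚ (a ℕ.* b) ≡ toℚ a * toℚ b
toℚ-* a b = trans (cong (_// 1) (ℤₚ.pos-* a b)) (sym (//-* (ℤ.+ a) (ℤ.+ b) 1 1))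

toℚ-^ : ∀ a k → toℚ (a ℕ.^ k) ≡ toℚ a ^ k
toℚ-^ a zero    = refl
toℚ-^ a (suc k) = trans (toℚ-* a (a ℕ.^ k)) (cong (toℚ a *_) (toℚ-^ a k))

1/-* : ∀ a b → 1/ (a ℕ.* b) ≡ 1/ a * 1/ b
1/-* a b = sym (//-* (ℤ.+ 1) (ℤ.+ 1) a b)

fraction-cong : ∀ a b c d → b ≢ 0 → d ≢ 0 → a ℕ.* d ≡ c ℕ.* b → toℚ a * 1/ b ≡ toℚ c * 1/ d
fraction-cong a zero    c d       b≢0 _   _  = contradiction refl b≢0
fraction-cong a (suc b) c zero    _   d≢0 _  = contradiction refl d≢0
fraction-cong a (suc b) c (suc d) _   _   eq = begin
  toℚ a * 1/ suc b  ≡⟨ //≡*1/ (ℤ.+ a) (suc b) ⟨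
  ℤ.+ a // suc b    ≡⟨ //-cross (ℤ.+ a) (ℤ.+ c) b d cross-multiplied ⟩
  ℤ.+ c // suc d    ≡⟨ //≡*1/ (ℤ.+ c) (suc d) ⟩
  toℚ c * 1/ suc d  ∎
  where
  open ≡-Reasoning
  cross-multiplied : ℤ.+ a ℤ.* ℤ.+ suc d ≡ ℤ.+ c ℤ.* ℤ.+ suc b
  cross-multiplied = trans (sym (ℤₚ.pos-* a (suc d))) (trans (cong ℤ.+_ eq) (ℤₚ.pos-* c (suc b)))

toℚ*1/-cancel : ∀ a → a ≢ 0 → toℚ a * 1/ a ≡ 1ℚ
toℚ*1/-cancel a a≢0 = fraction-cong a a 1 1 a≢0 (λ ()) (ℕₚ.*-comm a 1)

∑ : ℕ → (ℕ → ℚ) → ℚ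
∑ zero    f = 0ℚ
∑ (suc n) f = f 0 + ∑ n (λ k → f (suc k))

infix 9 ∑
syntax ∑ n (λ k → e) = ∑[ k < n ] e

∑-cong : ∀ n {f g : ℕ → ℚ} → (∀ k → k < n → f k ≡ g k) → ∑ n f ≡ ∑ n g
∑-cong zero    f≗g = refl
∑-cong (suc n) f≗g = cong₂ _+_ (f≗g 0 (s≤s z≤n)) (∑-cong n (λ k k<n → f≗g (suc k) (s≤s k<n)))

∑-zero : ∀ n {f : ℕ → ℚ} → (∀ k → k < n → f k ≡ 0ℚ) → ∑ n f ≡ 0ℚ
∑-zero zero    f≗0 = refl
∑-zero (suc n) f≗0 = cong₂ _+_ (f≗0 0 (s≤s z≤n)) (∑-zero n (λ k k<n → f≗0 (suc k) (s≤s k<n)))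

∑-distrib-+ : ∀ n (f g : ℕ → ℚ) → ∑[ k < n ] (f k + g k) ≡ ∑ n f + ∑ n g
∑-distrib-+ zero    f g = refl
∑-distrib-+ (suc n) f g =
  trans (cong (f 0 + g 0 +_) (∑-distrib-+ n (λ k → f (suc k)) (λ k → g (suc k))))
        (solve 4 (λ a b c d → a :+ b :+ (c :+ d) := a :+ c :+ (b :+ d)) refl
               (f 0) (g 0) (∑ n (λ k → f (suc k))) (∑ n (λ k → g (suc k))))

*-distribˡ-∑ : ∀ n c (f : ℕ → ℚ) → c * ∑ n f ≡ ∑[ k < n ] (c * f k)
*-distribˡ-∑ zero    c f = ℚₚ.*-zeroʳ c
*-distribˡ-∑ (suc n) c f =
  trans (ℚₚ.*-distribˡ-+ c (f 0) _) (cong (c * f 0 +_) (*-distribˡ-∑ n c (λ k → f (suc k))))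

*-distribʳ-∑ : ∀ n c (f : ℕ → ℚ) → ∑ n f * c ≡ ∑[ k < n ] (f k * c)
*-distribʳ-∑ n c f = trans (ℚₚ.*-comm (∑ n f) c)
  (trans (*-distribˡ-∑ n c f) (∑-cong n (λ k _ → ℚₚ.*-comm c (f k))))

∑-neg : ∀ n (f : ℕ → ℚ) → ∑[ k < n ] (- f k) ≡ - ∑ n f
∑-neg zero    f = refl
∑-neg (suc n) f =
  trans (cong (- f 0 +_) (∑-neg n (λ k → f (suc k)))) (sym (ℚₚ.neg-distrib-+ (f 0) _))

∑-distrib-sub : ∀ n (f g : ℕ → ℚ) → ∑[ k < n ] (f k - g k) ≡ ∑ n f - ∑ n g
∑-distrib-sub n f g = trans (∑-distrib-+ n f (λ k → - g k)) (cong (∑ n f +_) (∑-neg n g))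

∑-init-last : ∀ n (f : ℕ → ℚ) → ∑ (suc n) f ≡ ∑ n f + f n
∑-init-last zero    f = trans (ℚₚ.+-identityʳ (f 0)) (sym (ℚₚ.+-identityˡ (f 0)))
∑-init-last (suc n) f =
  trans (cong (f 0 +_) (∑-init-last n (λ k → f (suc k)))) (sym (ℚₚ.+-assoc (f 0) _ _))

∑-split : ∀ a b (f : ℕ → ℚ) → ∑ (a ℕ.+ b) f ≡ ∑ a f + (∑[ k < b ] f (a ℕ.+ k))
∑-split zero    b f = sym (ℚₚ.+-identityˡ _)
∑-split (suc a) b f =
  trans (cong (f 0 +_) (∑-split a b (λ k → f (suc k)))) (sym (ℚₚ.+-assoc (f 0) _ _))

∑-comm : ∀ a b (f : ℕ → ℕ → ℚ) → ∑[ i < a ] ∑[ j < b ] f i j ≡ ∑[ j < b ] ∑[ i < a ] f i j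
∑-comm zero    b f = sym (∑-zero b (λ _ _ → refl))
∑-comm (suc a) b f =
  trans (cong (_+_ (∑[ j < b ] f 0 j)) (∑-comm a b (λ i j → f (suc i) j)))
        (sym (∑-distrib-+ b (λ j → f 0 j) (λ j → ∑[ i < a ] f (suc i) j)))

∑-reverse : ∀ n (f : ℕ → ℚ) → ∑ (suc n) f ≡ ∑[ k < suc n ] f (n ∸ k)
∑-reverse zero    f = refl
∑-reverse (suc n) f = begin
  f 0 + ∑[ k < suc n ] f (suc k)              ≡⟨ cong (f 0 +_) (∑-reverse n (λ k → f (suc k))) ⟩
  f 0 + ∑[ k < suc n ] f (suc (n ∸ k))        ≡⟨ ℚₚ.+-comm (f 0) _ ⟩
  ∑[ k < suc n ] f (suc (n ∸ k)) + f 0        ≡⟨ cong₂ _+_ (∑-cong (suc n) (λ k k≤n →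
                                                   cong f (sym (ℕₚ.+-∸-assoc 1 (ℕₚ.≤-pred k≤n)))))
                                                 (cong f (sym (ℕₚ.n∸n≡0 n))) ⟩
  ∑[ k < suc n ] f (suc n ∸ k) + f (n ∸ n)    ≡⟨ ∑-init-last (suc n) (λ k → f (suc n ∸ k)) ⟨
  ∑[ k < suc (suc n) ] f (suc n ∸ k)          ∎
  where open ≡-Reasoning

sumℚ-applyUpTo : ∀ n (g : ℕ → ℚ) (h : ℕ → ℕ) → sumℚ (map g (applyUpTo h n)) ≡ ∑[ k < n ] g (h k)
sumℚ-applyUpTo zero    g h = refl
sumℚ-applyUpTo (suc n) g h = cong (g (h 0) +_) (sumℚ-applyUpTo n g (λ k → h (suc k)))

Σ-to≡∑ : ∀ a b (f : ℕ → ℚ) → Σ[ a to b ] f ≡ ∑[ k < suc b ∸ a ] f (a ℕ.+ k)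
Σ-to≡∑ a b f = sumℚ-applyUpTo (suc b ∸ a) (λ k → f (a ℕ.+ k)) (λ k → k)

sign : ℕ → ℚ
sign k = (- 1ℚ) ^ k

sign-suc : ∀ k → sign (suc k) ≡ - sign k
sign-suc k = trans (sym (ℚₚ.neg-distribˡ-* 1ℚ (sign k))) (cong -_ (ℚₚ.*-identityˡ (sign k)))

sign*sign : ∀ k → sign k * sign k ≡ 1ℚ
sign*sign zero    = refl
sign*sign (suc k) rewrite sign-suc k =
  trans (solve 1 (λ s → (:- s) :* (:- s) := s :* s) refl (sign k)) (sign*sign k)

sign-∸ : ∀ {i n} → i ≤ n → sign (n ∸ i) ≡ sign n * sign i
sign-∸ {i} {n} i≤n = sym (begin
  sign n * sign i                    ≡⟨ cong (λ k → sign k * sign i) (ℕₚ.m+[n∸m]≡n i≤n) ⟨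
  sign (i ℕ.+ (n ∸ i)) * sign i      ≡⟨ cong (_* sign i) (^-homo-* (- 1ℚ) i (n ∸ i)) ⟩
  sign i * sign (n ∸ i) * sign i     ≡⟨ solve 2 (λ s t → s :* t :* s := t :* (s :* s)) refl (sign i) (sign (n ∸ i)) ⟩
  sign (n ∸ i) * (sign i * sign i)   ≡⟨ cong (sign (n ∸ i) *_) (sign*sign i) ⟩
  sign (n ∸ i) * 1ℚ                  ≡⟨ ℚₚ.*-identityʳ _ ⟩
  sign (n ∸ i)                       ∎)
  where open ≡-Reasoning

^-neg : ∀ x k → (- x) ^ k ≡ sign k * x ^ k
^-neg x zero    = refl
^-neg x (suc k) rewrite sign-suc k | ^-neg x k =
  solve 3 (λ x s p → (:- x) :* (s :* p) := (:- s) :* (x :* p)) refl x (sign k) (x ^ k)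

binom-suc : ∀ n k → binom (suc n) (suc k) ≡ binom n k + binom n (suc k)
binom-suc n k = trans (cong toℚ (sym (nCk+nC[k+1]≡[n+1]C[k+1] n k))) (toℚ-+ (n C k) (n C suc k))

binom-> : ∀ {n k} → n < k → binom n k ≡ 0ℚ
binom-> n<k = cong toℚ (k>n⇒nCk≡0 n<k)

binom-diag : ∀ n → binom n n ≡ 1ℚ
binom-diag n = cong toℚ (nCn≡1 n)

∑-binom-extend : ∀ n (g : ℕ → ℚ) →
                 ∑[ l < suc (suc n) ] (binom n l * g l) ≡ ∑[ l < suc n ] (binom n l * g l)
∑-binom-extend n g = begin
  ∑[ l < suc (suc n) ] (binom n l * g l)                  ≡⟨ ∑-init-last (suc n) (λ l → binom n l * g l) ⟩
  ∑[ l < suc n ] (binom n l * g l) + binom n (suc n) * g (suc n)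
    ≡⟨ cong (λ c → ∑[ l < suc n ] (binom n l * g l) + c * g (suc n)) (binom-> (ℕₚ.n<1+n n)) ⟩
  ∑[ l < suc n ] (binom n l * g l) + 0ℚ * g (suc n)
    ≡⟨ solve 2 (λ s x → s :+ con 0ℚ :* x := s) refl (∑[ l < suc n ] (binom n l * g l)) (g (suc n)) ⟩
  ∑[ l < suc n ] (binom n l * g l)                        ∎
  where open ≡-Reasoning

∑-pascal : ∀ n (g : ℕ → ℚ) →
           ∑[ l < suc (suc n) ] (binom (suc n) l * g l) ≡ ∑[ l < suc n ] (binom n l * (g l + g (suc l)))
∑-pascal n g = begin
  1ℚ * g 0 + ∑[ l < suc n ] (binom (suc n) (suc l) * g (suc l))
    ≡⟨ cong (1ℚ * g 0 +_) (trans (∑-cong (suc n) (λ l _ →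
          trans (cong (_* g (suc l)) (binom-suc n l)) (ℚₚ.*-distribʳ-+ (g (suc l)) (binom n l) (binom n (suc l)))))
        (∑-distrib-+ (suc n) (λ l → binom n l * g (suc l)) (λ l → binom n (suc l) * g (suc l)))) ⟩
  1ℚ * g 0 + (shifted + raised)
    ≡⟨ solve 3 (λ a b c → con 1ℚ :* a :+ (b :+ c) := (con 1ℚ :* a :+ c) :+ b) refl (g 0) shifted raised ⟩
  ∑[ l < suc (suc n) ] (binom n l * g l) + shifted
    ≡⟨ cong (_+ shifted) (∑-binom-extend n g) ⟩
  ∑[ l < suc n ] (binom n l * g l) + shifted
    ≡⟨ ∑-distrib-+ (suc n) (λ l → binom n l * g l) (λ l → binom n l * g (suc l)) ⟨
  ∑[ l < suc n ] (binom n l * g l + binom n l * g (suc l))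
    ≡⟨ ∑-cong (suc n) (λ l _ → sym (ℚₚ.*-distribˡ-+ (binom n l) (g l) (g (suc l)))) ⟩
  ∑[ l < suc n ] (binom n l * (g l + g (suc l)))          ∎
  where
  open ≡-Reasoning
  shifted raised : ℚ
  shifted = ∑[ l < suc n ] (binom n l * g (suc l))
  raised  = ∑[ l < suc n ] (binom n (suc l) * g (suc l))

binomial-theorem : ∀ x M → (x + 1ℚ) ^ M ≡ ∑[ j < suc M ] (binom M j * x ^ j)
binomial-theorem x zero    = sym (ℚₚ.+-identityʳ _)
binomial-theorem x (suc M) = begin
  (x + 1ℚ) * (x + 1ℚ) ^ M                           ≡⟨ cong ((x + 1ℚ) *_) (binomial-theorem x M) ⟩
  (x + 1ℚ) * ∑[ j < suc M ] (binom M j * x ^ j)     ≡⟨ *-distribˡ-∑ (suc M) (x + 1ℚ) (λ j → binom M j * x ^ j) ⟩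
  ∑[ j < suc M ] ((x + 1ℚ) * (binom M j * x ^ j))   ≡⟨ ∑-cong (suc M) (λ j _ →
      solve 3 (λ x b p → (x :+ con 1ℚ) :* (b :* p) := b :* (p :+ x :* p)) refl x (binom M j) (x ^ j)) ⟩
  ∑[ j < suc M ] (binom M j * (x ^ j + x ^ suc j))  ≡⟨ ∑-pascal M (x ^_) ⟨
  ∑[ j < suc (suc M) ] (binom (suc M) j * x ^ j)    ∎
  where open ≡-Reasoning

-- Finite differences and surjection numbers

Δ : ℕ → (ℕ → ℚ) → ℚ
Δ n F = ∑[ l < suc n ] (sign (n ∸ l) * binom n l * F l)

Δ-suc : ∀ n F → Δ (suc n) F ≡ Δ n (λ l → F (suc l) - F l)
Δ-suc n F = begin
  ∑[ l < suc (suc n) ] (sign (suc n ∸ l) * binom (suc n) l * F l)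
    ≡⟨ ∑-cong (suc (suc n)) (λ l _ →
         solve 3 (λ s b f → s :* b :* f := b :* (s :* f)) refl (sign (suc n ∸ l)) (binom (suc n) l) (F l)) ⟩
  ∑[ l < suc (suc n) ] (binom (suc n) l * G l)
    ≡⟨ ∑-pascal n G ⟩
  ∑[ l < suc n ] (binom n l * (G l + G (suc l)))
    ≡⟨ ∑-cong (suc n) (λ l l<n → telescope l (ℕₚ.≤-pred l<n)) ⟩
  ∑[ l < suc n ] (sign (n ∸ l) * binom n l * (F (suc l) - F l))  ∎
  where
  open ≡-Reasoning
  G : ℕ → ℚ
  G l = sign (suc n ∸ l) * F l
  telescope : ∀ l → l ≤ n → binom n l * (G l + G (suc l)) ≡ sign (n ∸ l) * binom n l * (F (suc l) - F l)
  telescope l l≤n rewrite ℕₚ.+-∸-assoc 1 l≤n | sign-suc (n ∸ l) =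
    solve 4 (λ b s f g → b :* ((:- s) :* f :+ s :* g) := s :* b :* (g :- f)) refl
            (binom n l) (sign (n ∸ l)) (F l) (F (suc l))

-- By inclusion–exclusion, the number of surjections from an M-set onto an n-set.
surjections : ℕ → ℕ → ℚ
surjections n M = Δ n (λ l → toℚ l ^ M)

^-forward-difference : ∀ l M → toℚ (suc l) ^ M - toℚ l ^ M ≡ ∑[ j < M ] (binom M j * toℚ l ^ j)
^-forward-difference l M = begin
  toℚ (suc l) ^ M - toℚ l ^ M                     ≡⟨ cong (λ x → x ^ M - toℚ l ^ M) (trans (toℚ-+ 1 l) (ℚₚ.+-comm 1ℚ (toℚ l))) ⟩
  (toℚ l + 1ℚ) ^ M - toℚ l ^ M                    ≡⟨ cong (_- toℚ l ^ M) (trans (binomial-theorem (toℚ l) M) (∑-init-last M _)) ⟩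
  lower + binom M M * toℚ l ^ M - toℚ l ^ M       ≡⟨ cong (λ c → lower + c * toℚ l ^ M - toℚ l ^ M) (binom-diag M) ⟩
  lower + 1ℚ * toℚ l ^ M - toℚ l ^ M              ≡⟨ solve 2 (λ s p → s :+ con 1ℚ :* p :- p := s) refl lower (toℚ l ^ M) ⟩
  lower                                           ∎
  where
  open ≡-Reasoning
  lower : ℚ
  lower = ∑[ j < M ] (binom M j * toℚ l ^ j)

surjections-suc : ∀ n M → surjections (suc n) M ≡ ∑[ j < M ] (binom M j * surjections n j)
surjections-suc n M = begin
  surjections (suc n) M
    ≡⟨ Δ-suc n (λ l → toℚ l ^ M) ⟩
  ∑[ l < suc n ] (sign (n ∸ l) * binom n l * (toℚ (suc l) ^ M - toℚ l ^ M))
    ≡⟨ ∑-cong (suc n) (λ l _ → trans (cong (sign (n ∸ l) * binom n l *_) (^-forward-difference l M))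
                                      (*-distribˡ-∑ M (sign (n ∸ l) * binom n l) (λ j → binom M j * toℚ l ^ j))) ⟩
  ∑[ l < suc n ] ∑[ j < M ] (sign (n ∸ l) * binom n l * (binom M j * toℚ l ^ j))
    ≡⟨ ∑-comm (suc n) M (λ l j → sign (n ∸ l) * binom n l * (binom M j * toℚ l ^ j)) ⟩
  ∑[ j < M ] ∑[ l < suc n ] (sign (n ∸ l) * binom n l * (binom M j * toℚ l ^ j))
    ≡⟨ ∑-cong M (λ j _ → trans
         (∑-cong (suc n) (λ l _ → solve 4 (λ s b c p → s :* b :* (c :* p) := c :* (s :* b :* p)) refl
                                          (sign (n ∸ l)) (binom n l) (binom M j) (toℚ l ^ j)))
         (sym (*-distribˡ-∑ (suc n) (binom M j) (λ l → sign (n ∸ l) * binom n l * toℚ l ^ j)))) ⟩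
  ∑[ j < M ] (binom M j * surjections n j)  ∎
  where open ≡-Reasoning

surjections-< : ∀ {n M} → M < n → surjections n M ≡ 0ℚ
surjections-< {suc n} {M} M<n = trans (surjections-suc n M) (∑-zero M (λ j j<M →
  trans (cong (binom M j *_) (surjections-< (ℕₚ.≤-trans j<M (ℕₚ.≤-pred M<n)))) (ℚₚ.*-zeroʳ (binom M j))))

alternatingSum : ℕ → (ℕ → ℚ) → ℚ
alternatingSum n F = ∑[ i < suc n ] (sign i * binom n i * F i)

alternatingSum-cong : ∀ n {F G : ℕ → ℚ} → (∀ i → F i ≡ G i) → alternatingSum n F ≡ alternatingSum n G
alternatingSum-cong n F≗G = ∑-cong (suc n) (λ i _ → cong (sign i * binom n i *_) (F≗G i))

alternatingSum-sub : ∀ n (F G : ℕ → ℚ) → alternatingSum n (λ i → F i - G i) ≡ alternatingSum n F - alternatingSum n G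
alternatingSum-sub n F G = trans
  (∑-cong (suc n) (λ i _ → solve 4 (λ s b f g → s :* b :* (f :- g) := s :* b :* f :- s :* b :* g) refl
                                   (sign i) (binom n i) (F i) (G i)))
  (∑-distrib-sub (suc n) (λ i → sign i * binom n i * F i) (λ i → sign i * binom n i * G i))

alternatingSum-*ˡ : ∀ n c (F : ℕ → ℚ) → alternatingSum n (λ i → c * F i) ≡ c * alternatingSum n F
alternatingSum-*ˡ n c F = trans
  (∑-cong (suc n) (λ i _ → solve 4 (λ s b c f → s :* b :* (c :* f) := c :* (s :* b :* f)) refl
                                   (sign i) (binom n i) c (F i)))
  (sym (*-distribˡ-∑ (suc n) c (λ i → sign i * binom n i * F i)))

alternatingSum-∑ : ∀ n J (F : ℕ → ℕ → ℚ) →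
                   alternatingSum n (λ i → ∑[ j < J ] F j i) ≡ ∑[ j < J ] alternatingSum n (F j)
alternatingSum-∑ n J F = begin
  ∑[ i < suc n ] (sign i * binom n i * ∑[ j < J ] F j i)    ≡⟨ ∑-cong (suc n) (λ i _ → *-distribˡ-∑ J (sign i * binom n i) (λ j → F j i)) ⟩
  ∑[ i < suc n ] ∑[ j < J ] (sign i * binom n i * F j i)    ≡⟨ ∑-comm (suc n) J (λ i j → sign i * binom n i * F j i) ⟩
  ∑[ j < J ] ∑[ i < suc n ] (sign i * binom n i * F j i)    ∎
  where open ≡-Reasoning

alternatingSum≡sign*Δ : ∀ n F → alternatingSum n F ≡ sign n * Δ n F
alternatingSum≡sign*Δ n F = trans (∑-cong (suc n) (λ i i≤n → resign i (ℕₚ.≤-pred i≤n)))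
                          (sym (*-distribˡ-∑ (suc n) (sign n) (λ i → sign (n ∸ i) * binom n i * F i)))
  where
  resign : ∀ i → i ≤ n → sign i * binom n i * F i ≡ sign n * (sign (n ∸ i) * binom n i * F i)
  resign i i≤n = begin
    sign i * binom n i * F i                            ≡⟨ ℚₚ.*-identityˡ _ ⟨
    1ℚ * (sign i * binom n i * F i)                     ≡⟨ cong (_* (sign i * binom n i * F i)) (sign*sign n) ⟨
    sign n * sign n * (sign i * binom n i * F i)        ≡⟨ solve 5 (λ a b c d e → a :* b :* (c :* d :* e) := a :* (b :* c :* d :* e)) refl
                                                             (sign n) (sign n) (sign i) (binom n i) (F i) ⟩
    sign n * (sign n * sign i * binom n i * F i)        ≡⟨ cong (λ s → sign n * (s * binom n i * F i)) (sign-∸ i≤n) ⟨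
    sign n * (sign (n ∸ i) * binom n i * F i)           ∎
    where open ≡-Reasoning

alternatingSum-power-< : ∀ {n k} → k < n → alternatingSum n (λ i → toℚ i ^ k) ≡ 0ℚ
alternatingSum-power-< {n} {k} k<n = begin
  alternatingSum n (λ i → toℚ i ^ k)   ≡⟨ alternatingSum≡sign*Δ n (λ i → toℚ i ^ k) ⟩
  sign n * surjections n k             ≡⟨ cong (sign n *_) (surjections-< k<n) ⟩
  sign n * 0ℚ                          ≡⟨ ℚₚ.*-zeroʳ (sign n) ⟩
  0ℚ                                   ∎
  where open ≡-Reasoning

fact≡! : ∀ n → fact n ≡ n !
fact≡! zero    = refl
fact≡! (suc n) = cong (suc n ℕ.*_) (fact≡! n)

fact≢0 : ∀ n → fact n ≢ 0
fact≢0 n rewrite fact≡! n = ℕ.≢-nonZero⁻¹ (n !) {{ℕₚ._!≢0 n}}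

binom*fact*fact : ∀ {a N} → a ≤ N → (N C a) ℕ.* (fact a ℕ.* fact (N ∸ a)) ≡ fact N
binom*fact*fact {a} {N} a≤N rewrite fact≡! a | fact≡! (N ∸ a) | fact≡! N =
  trans (cong (ℕ._* (a ! ℕ.* (N ∸ a) !)) (nCk≡n!/k![n-k]! a≤N))
        (m/n*n≡m {{ℕₚ._!*_!≢0 a (N ∸ a)}} (k![n∸k]!∣n! a≤N))

binom*1/fact : ∀ {a N} → a ≤ N → binom N a * 1/ fact N ≡ 1/ fact a * 1/ fact (N ∸ a)
binom*1/fact {a} {N} a≤N = begin
  toℚ (N C a) * 1/ fact N                    ≡⟨ fraction-cong (N C a) (fact N) 1 (fact a ℕ.* fact (N ∸ a))
                                                  (fact≢0 N) fact*fact≢0 (trans (binom*fact*fact a≤N) (sym (ℕₚ.*-identityˡ _))) ⟩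
  1ℚ * 1/ (fact a ℕ.* fact (N ∸ a))          ≡⟨ ℚₚ.*-identityˡ _ ⟩
  1/ (fact a ℕ.* fact (N ∸ a))               ≡⟨ 1/-* (fact a) (fact (N ∸ a)) ⟩
  1/ fact a * 1/ fact (N ∸ a)                ∎
  where
  open ≡-Reasoning
  fact*fact≢0 : fact a ℕ.* fact (N ∸ a) ≢ 0
  fact*fact≢0 rewrite fact≡! a | fact≡! (N ∸ a) = ℕ.≢-nonZero⁻¹ _ {{ℕₚ._!*_!≢0 a (N ∸ a)}}

-- Compositions

sumℚ-map-cong : ∀ {A : Set} {f g : A → ℚ} (xs : List A) → (∀ x → f x ≡ g x) → sumℚ (map f xs) ≡ sumℚ (map g xs)
sumℚ-map-cong xs f≗g = cong sumℚ (Listₚ.map-cong f≗g xs)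

sumℚ-map-zero : ∀ {A : Set} {f : A → ℚ} (xs : List A) → (∀ x → f x ≡ 0ℚ) → sumℚ (map f xs) ≡ 0ℚ
sumℚ-map-zero []       f≗0 = refl
sumℚ-map-zero (x ∷ xs) f≗0 = cong₂ _+_ (f≗0 x) (sumℚ-map-zero xs f≗0)

*-distribˡ-sumℚ : ∀ {A : Set} c (f : A → ℚ) (xs : List A) → c * sumℚ (map f xs) ≡ sumℚ (map (λ x → c * f x) xs)
*-distribˡ-sumℚ c f []       = ℚₚ.*-zeroʳ c
*-distribˡ-sumℚ c f (x ∷ xs) = trans (ℚₚ.*-distribˡ-+ c (f x) _) (cong (c * f x +_) (*-distribˡ-sumℚ c f xs))

sumℚ-++ : (xs ys : List ℚ) → sumℚ (xs ++ ys) ≡ sumℚ xs + sumℚ ys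
sumℚ-++ []       ys = sym (ℚₚ.+-identityˡ _)
sumℚ-++ (x ∷ xs) ys = trans (cong (x +_) (sumℚ-++ xs ys)) (sym (ℚₚ.+-assoc x _ _))

sumℚ-concatMap : ∀ {A B : Set} (h : B → ℚ) (f : A → List B) (xs : List A) →
                 sumℚ (map h (concatMap f xs)) ≡ sumℚ (map (λ x → sumℚ (map h (f x))) xs)
sumℚ-concatMap h f []       = refl
sumℚ-concatMap h f (x ∷ xs) = begin
  sumℚ (map h (f x ++ concatMap f xs))                  ≡⟨ cong sumℚ (Listₚ.map-++ h (f x) (concatMap f xs)) ⟩
  sumℚ (map h (f x) ++ map h (concatMap f xs))          ≡⟨ sumℚ-++ (map h (f x)) (map h (concatMap f xs)) ⟩
  sumℚ (map h (f x)) + sumℚ (map h (concatMap f xs))    ≡⟨ cong (sumℚ (map h (f x)) +_) (sumℚ-concatMap h f xs) ⟩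
  sumℚ (map h (f x)) + sumℚ (map (λ y → sumℚ (map h (f y))) xs) ∎
  where open ≡-Reasoning

sumℚ-filter : ∀ {A : Set} {P : A → Set} (P? : ∀ x → Dec (P x)) (f : A → ℚ) (xs : List A) →
              sumℚ (map f (filter P? xs)) ≡ sumℚ (map (λ x → if does (P? x) then f x else 0ℚ) xs)
sumℚ-filter P? f []       = refl
sumℚ-filter P? f (x ∷ xs) with does (P? x)
... | true  = cong (f x +_) (sumℚ-filter P? f xs)
... | false = trans (sumℚ-filter P? f xs) (sym (ℚₚ.+-identityˡ _))

*-if-then-else-0 : ∀ (b : Bool) c x → c * (if b then x else 0ℚ) ≡ (if b then c * x else 0ℚ)
*-if-then-else-0 true  c x = refl
*-if-then-else-0 false c x = ℚₚ.*-zeroʳ c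

weight : ∀ {n} → Vec ℕ n → ℚ
weight []      = 1ℚ
weight (k ∷ v) = 1/ fact (suc k) * weight v

weight-multinomial : ∀ m {n} (v : Vec ℕ n) →
  multinomial m v * (ℤ.+ 1 // product (Vec.toList (Vec.map suc v))) ≡ toℚ (fact m) * weight v
weight-multinomial m v = begin
  (ℤ.+ fact m // facts v) * 1/ succs v      ≡⟨ cong (_* 1/ succs v) (//≡*1/ (ℤ.+ fact m) (facts v)) ⟩
  toℚ (fact m) * 1/ facts v * 1/ succs v   ≡⟨ ℚₚ.*-assoc (toℚ (fact m)) _ _ ⟩
  toℚ (fact m) * (1/ facts v * 1/ succs v) ≡⟨ cong (toℚ (fact m) *_) (1/facts*1/succs v) ⟩
  toℚ (fact m) * weight v                  ∎
  where
  open ≡-Reasoning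
  facts succs : ∀ {n} → Vec ℕ n → ℕ
  facts v = product (Vec.toList (Vec.map fact v))
  succs v = product (Vec.toList (Vec.map suc v))
  1/facts*1/succs : ∀ {n} (v : Vec ℕ n) → 1/ facts v * 1/ succs v ≡ weight v
  1/facts*1/succs []      = refl
  1/facts*1/succs (k ∷ v) rewrite 1/-* (fact k) (facts v) | 1/-* (suc k) (succs v) | 1/-* (suc k) (fact k) =
    trans (solve 4 (λ a b c d → a :* b :* (c :* d) := c :* a :* (b :* d)) refl
                   (1/ fact k) (1/ facts v) (1/ suc k) (1/ succs v))
          (cong (1/ suc k * 1/ fact k *_) (1/facts*1/succs v))

-- Only tuples with entries ≤ M are enumerated; for s ≤ M this loses no composition of s.
compositionWeight : ℕ → ℕ → ℕ → ℚ
compositionWeight n M s = sumℚ (map (λ v → if does (Vec.sum v ≟ s) then weight v else 0ℚ) (tuples n M))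

rhs≡fact*compositionWeight : ∀ n m → rhs n m ≡ toℚ (fact m) * compositionWeight n m m
rhs≡fact*compositionWeight n m = begin
  rhs n m
    ≡⟨ sumℚ-filter (λ v → Vec.sum v ≟ m) _ (tuples n m) ⟩
  sumℚ (map (λ v → if does (Vec.sum v ≟ m) then summand v else 0ℚ) (tuples n m))
    ≡⟨ sumℚ-map-cong (tuples n m) (λ v → trans
         (cong (λ x → if does (Vec.sum v ≟ m) then x else 0ℚ) (weight-multinomial m v))
         (sym (*-if-then-else-0 (does (Vec.sum v ≟ m)) (toℚ (fact m)) (weight v)))) ⟩
  sumℚ (map (λ v → toℚ (fact m) * (if does (Vec.sum v ≟ m) then weight v else 0ℚ)) (tuples n m))
    ≡⟨ *-distribˡ-sumℚ (toℚ (fact m)) _ (tuples n m) ⟨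
  toℚ (fact m) * compositionWeight n m m
    ∎
  where
  open ≡-Reasoning
  summand : Vec ℕ n → ℚ
  summand v = multinomial m v * (ℤ.+ 1 // product (Vec.toList (Vec.map suc v)))

compositionWeightHead : ℕ → ℕ → ℕ → ℕ → ℚ
compositionWeightHead n M s k =
  sumℚ (map (λ v → if does (k ℕ.+ Vec.sum v ≟ s) then 1/ fact (suc k) * weight v else 0ℚ) (tuples n M))

compositionWeight-suc : ∀ n M s → compositionWeight (suc n) M s ≡ ∑[ k < suc M ] compositionWeightHead n M s k
compositionWeight-suc n M s = begin
  sumℚ (map h (concatMap (λ k → map (k ∷_) (tuples n M)) (upTo (suc M))))
    ≡⟨ sumℚ-concatMap h (λ k → map (k ∷_) (tuples n M)) (upTo (suc M)) ⟩
  sumℚ (map (λ k → sumℚ (map h (map (k ∷_) (tuples n M)))) (upTo (suc M)))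
    ≡⟨ sumℚ-applyUpTo (suc M) (λ k → sumℚ (map h (map (k ∷_) (tuples n M)))) (λ k → k) ⟩
  ∑[ k < suc M ] sumℚ (map h (map (k ∷_) (tuples n M)))
    ≡⟨ ∑-cong (suc M) (λ k _ → cong sumℚ (sym (Listₚ.map-∘ {g = h} {f = k ∷_} (tuples n M)))) ⟩
  ∑[ k < suc M ] compositionWeightHead n M s k
    ∎
  where
  open ≡-Reasoning
  h : Vec ℕ (suc n) → ℚ
  h v = if does (Vec.sum v ≟ s) then weight v else 0ℚ

compositionWeightHead-≤ : ∀ {k s} n M → k ≤ s →
  compositionWeightHead n M s k ≡ 1/ fact (suc k) * compositionWeight n M (s ∸ k)
compositionWeightHead-≤ {k} {s} n M k≤s = begin
  compositionWeightHead n M s k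
    ≡⟨ sumℚ-map-cong (tuples n M) (λ v → trans
         (cong (λ b → if b then 1/ fact (suc k) * weight v else 0ℚ) (head-condition (Vec.sum v)))
         (sym (*-if-then-else-0 (does (Vec.sum v ≟ s ∸ k)) (1/ fact (suc k)) (weight v)))) ⟩
  sumℚ (map (λ v → 1/ fact (suc k) * (if does (Vec.sum v ≟ s ∸ k) then weight v else 0ℚ)) (tuples n M))
    ≡⟨ *-distribˡ-sumℚ (1/ fact (suc k)) _ (tuples n M) ⟨
  1/ fact (suc k) * compositionWeight n M (s ∸ k)
    ∎
  where
  open ≡-Reasoning
  head-condition : ∀ t → does (k ℕ.+ t ≟ s) ≡ does (t ≟ s ∸ k)
  head-condition t with t ≟ s ∸ k
  ... | yes t≡s∸k = trans (dec-true (k ℕ.+ t ≟ s) (trans (cong (k ℕ.+_) t≡s∸k) (ℕₚ.m+[n∸m]≡n k≤s)))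
                          (sym (dec-true (t ≟ s ∸ k) t≡s∸k))
  ... | no  t≢s∸k = trans (dec-false (k ℕ.+ t ≟ s) (λ k+t≡s → t≢s∸k (trans (sym (ℕₚ.m+n∸m≡n k t)) (cong (_∸ k) k+t≡s))))
                          (sym (dec-false (t ≟ s ∸ k) t≢s∸k))

compositionWeightHead-> : ∀ {k s} n M → s < k → compositionWeightHead n M s k ≡ 0ℚ
compositionWeightHead-> {k} {s} n M s<k = sumℚ-map-zero (tuples n M) (λ v →
  cong (λ b → if b then 1/ fact (suc k) * weight v else 0ℚ)
       (dec-false (k ℕ.+ Vec.sum v ≟ s) (λ k+t≡s → ℕₚ.<⇒≱ s<k (subst (k ≤_) k+t≡s (ℕₚ.m≤m+n k (Vec.sum v))))))

compositionWeight-suc-≤ : ∀ n {M s} → s ≤ M →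
  compositionWeight (suc n) M s ≡ ∑[ k < suc s ] (1/ fact (suc k) * compositionWeight n M (s ∸ k))
compositionWeight-suc-≤ n {M} {s} s≤M = begin
  compositionWeight (suc n) M s
    ≡⟨ compositionWeight-suc n M s ⟩
  ∑[ k < suc M ] compositionWeightHead n M s k
    ≡⟨ cong (λ t → ∑ (suc t) (compositionWeightHead n M s)) (ℕₚ.m+[n∸m]≡n s≤M) ⟨
  ∑ (suc s ℕ.+ (M ∸ s)) (compositionWeightHead n M s)
    ≡⟨ ∑-split (suc s) (M ∸ s) (compositionWeightHead n M s) ⟩
  ∑ (suc s) (compositionWeightHead n M s) + ∑[ k < M ∸ s ] compositionWeightHead n M s (suc s ℕ.+ k)
    ≡⟨ cong₂ _+_ (∑-cong (suc s) (λ k k≤s → compositionWeightHead-≤ n M (ℕₚ.≤-pred k≤s)))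
                 (∑-zero (M ∸ s) (λ k _ → compositionWeightHead-> n M (s≤s (ℕₚ.m≤m+n s k)))) ⟩
  ∑[ k < suc s ] (1/ fact (suc k) * compositionWeight n M (s ∸ k)) + 0ℚ
    ≡⟨ ℚₚ.+-identityʳ _ ⟩
  ∑[ k < suc s ] (1/ fact (suc k) * compositionWeight n M (s ∸ k))
    ∎
  where open ≡-Reasoning

surjections-suc-reversed : ∀ n s →
  surjections (suc n) (suc (n ℕ.+ s)) ≡
  ∑[ k < suc s ] (binom (suc (n ℕ.+ s)) (n ℕ.+ (s ∸ k)) * surjections n (n ℕ.+ (s ∸ k)))
surjections-suc-reversed n s = begin
  surjections (suc n) N                      ≡⟨ surjections-suc n N ⟩
  ∑ N f                                      ≡⟨ cong (λ t → ∑ t f) (ℕₚ.+-suc n s) ⟨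
  ∑ (n ℕ.+ suc s) f                          ≡⟨ ∑-split n (suc s) f ⟩
  ∑ n f + ∑[ t < suc s ] f (n ℕ.+ t)         ≡⟨ cong (_+ ∑[ t < suc s ] f (n ℕ.+ t)) (∑-zero n (λ j j<n →
                                                  trans (cong (binom N j *_) (surjections-< j<n)) (ℚₚ.*-zeroʳ (binom N j)))) ⟩
  0ℚ + ∑[ t < suc s ] f (n ℕ.+ t)            ≡⟨ ℚₚ.+-identityˡ _ ⟩
  ∑[ t < suc s ] f (n ℕ.+ t)                 ≡⟨ ∑-reverse s (λ t → f (n ℕ.+ t)) ⟩
  ∑[ k < suc s ] f (n ℕ.+ (s ∸ k))           ∎
  where
  open ≡-Reasoning
  N : ℕ
  N = suc (n ℕ.+ s)
  f : ℕ → ℚ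
  f j = binom N j * surjections n j

1/fact*1/fact≡binom*1/fact : ∀ n {s k} → k ≤ s →
  1/ fact (suc k) * 1/ fact (n ℕ.+ (s ∸ k)) ≡ binom (suc (n ℕ.+ s)) (n ℕ.+ (s ∸ k)) * 1/ fact (suc (n ℕ.+ s))
1/fact*1/fact≡binom*1/fact n {s} {k} k≤s = begin
  1/ fact (suc k) * 1/ fact a       ≡⟨ ℚₚ.*-comm (1/ fact (suc k)) (1/ fact a) ⟩
  1/ fact a * 1/ fact (suc k)       ≡⟨ cong (λ t → 1/ fact a * 1/ fact t) N∸a≡1+k ⟨
  1/ fact a * 1/ fact (N ∸ a)       ≡⟨ binom*1/fact a≤N ⟨
  binom N a * 1/ fact N             ∎
  where
  open ≡-Reasoning
  a N : ℕ
  a = n ℕ.+ (s ∸ k)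
  N = suc (n ℕ.+ s)
  a+1+k≡N : a ℕ.+ suc k ≡ N
  a+1+k≡N = trans (ℕₚ.+-assoc n (s ∸ k) (suc k))
    (trans (cong (n ℕ.+_) (trans (ℕₚ.+-suc (s ∸ k) k) (cong suc (ℕₚ.m∸n+n≡m k≤s)))) (ℕₚ.+-suc n s))
  N∸a≡1+k : N ∸ a ≡ suc k
  N∸a≡1+k = trans (cong (_∸ a) (sym a+1+k≡N)) (ℕₚ.m+n∸m≡n a (suc k))
  a≤N : a ≤ N
  a≤N = subst (a ≤_) a+1+k≡N (ℕₚ.m≤m+n a (suc k))

compositionWeight-closed : ∀ n {M s} → s ≤ M → compositionWeight n M s ≡ surjections n (n ℕ.+ s) * 1/ fact (n ℕ.+ s)
compositionWeight-closed zero    {s = zero}  _ = refl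
compositionWeight-closed zero    {s = suc s} _ = sym (begin
  (1ℚ * 1ℚ * (0ℚ * 0ℚ ^ s) + 0ℚ) * 1/ fact (suc s)  ≡⟨ cong (λ z → (1ℚ * 1ℚ * z + 0ℚ) * 1/ fact (suc s)) (ℚₚ.*-zeroˡ (0ℚ ^ s)) ⟩
  (1ℚ * 1ℚ * 0ℚ + 0ℚ) * 1/ fact (suc s)             ≡⟨ solve 1 (λ y → (con 1ℚ :* con 1ℚ :* con 0ℚ :+ con 0ℚ) :* y := con 0ℚ) refl (1/ fact (suc s)) ⟩
  0ℚ                                                ∎)
  where open ≡-Reasoning
compositionWeight-closed (suc n) {M} {s} s≤M = begin
  compositionWeight (suc n) M s
    ≡⟨ compositionWeight-suc-≤ n s≤M ⟩
  ∑[ k < suc s ] (1/ fact (suc k) * compositionWeight n M (s ∸ k))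
    ≡⟨ ∑-cong (suc s) (λ k k≤s → cong (1/ fact (suc k) *_)
         (compositionWeight-closed n (ℕₚ.≤-trans (ℕₚ.m∸n≤m s k) s≤M))) ⟩
  ∑[ k < suc s ] (1/ fact (suc k) * (surjections n (a k) * 1/ fact (a k)))
    ≡⟨ ∑-cong (suc s) (λ k k≤s → regroup k (ℕₚ.≤-pred k≤s)) ⟩
  ∑[ k < suc s ] (1/ fact N * (binom N (a k) * surjections n (a k)))
    ≡⟨ *-distribˡ-∑ (suc s) (1/ fact N) (λ k → binom N (a k) * surjections n (a k)) ⟨
  1/ fact N * ∑[ k < suc s ] (binom N (a k) * surjections n (a k))
    ≡⟨ cong (1/ fact N *_) (surjections-suc-reversed n s) ⟨
  1/ fact N * surjections (suc n) N
    ≡⟨ ℚₚ.*-comm (1/ fact N) _ ⟩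
  surjections (suc n) N * 1/ fact N
    ∎
  where
  open ≡-Reasoning
  N : ℕ
  N = suc (n ℕ.+ s)
  a : ℕ → ℕ
  a k = n ℕ.+ (s ∸ k)
  regroup : ∀ k → k ≤ s → 1/ fact (suc k) * (surjections n (a k) * 1/ fact (a k))
                        ≡ 1/ fact N * (binom N (a k) * surjections n (a k))
  regroup k k≤s = begin
    1/ fact (suc k) * (surjections n (a k) * 1/ fact (a k))  ≡⟨ solve 3 (λ x y z → x :* (y :* z) := (x :* z) :* y) refl
                                                                    (1/ fact (suc k)) (surjections n (a k)) (1/ fact (a k)) ⟩
    1/ fact (suc k) * 1/ fact (a k) * surjections n (a k)    ≡⟨ cong (_* surjections n (a k)) (1/fact*1/fact≡binom*1/fact n k≤s) ⟩
    binom N (a k) * 1/ fact N * surjections n (a k)          ≡⟨ solve 3 (λ b x y → b :* x :* y := x :* (b :* y)) refl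
                                                                    (binom N (a k)) (1/ fact N) (surjections n (a k)) ⟩
    1/ fact N * (binom N (a k) * surjections n (a k))        ∎

-- The beta sum

-- ∫₀¹ xᵐ (1 - x)ᵖ dx, expanded by the binomial theorem.
betaSum : ℕ → ℕ → ℚ
betaSum p m = ∑[ j < suc p ] (sign j * binom p j * 1/ (m ℕ.+ j ℕ.+ 1))

betaSum-suc : ∀ p m → betaSum (suc p) m ≡ betaSum p m - betaSum p (suc m)
betaSum-suc p m = begin
  betaSum (suc p) m
    ≡⟨ ∑-cong (suc (suc p)) (λ j _ → solve 3 (λ s b i → s :* b :* i := b :* (s :* i)) refl
                                             (sign j) (binom (suc p) j) (1/ (m ℕ.+ j ℕ.+ 1))) ⟩
  ∑[ j < suc (suc p) ] (binom (suc p) j * g j)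
    ≡⟨ ∑-pascal p g ⟩
  ∑[ j < suc p ] (binom p j * (g j + g (suc j)))
    ≡⟨ ∑-cong (suc p) (λ j _ → split j) ⟩
  ∑[ j < suc p ] (sign j * binom p j * 1/ (m ℕ.+ j ℕ.+ 1) - sign j * binom p j * 1/ (suc m ℕ.+ j ℕ.+ 1))
    ≡⟨ ∑-distrib-sub (suc p) (λ j → sign j * binom p j * 1/ (m ℕ.+ j ℕ.+ 1))
                           (λ j → sign j * binom p j * 1/ (suc m ℕ.+ j ℕ.+ 1)) ⟩
  betaSum p m - betaSum p (suc m)
    ∎
  where
  open ≡-Reasoning
  g : ℕ → ℚ
  g j = sign j * 1/ (m ℕ.+ j ℕ.+ 1)
  split : ∀ j → binom p j * (g j + g (suc j))
              ≡ sign j * binom p j * 1/ (m ℕ.+ j ℕ.+ 1) - sign j * binom p j * 1/ (suc m ℕ.+ j ℕ.+ 1)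
  split j rewrite ℕₚ.+-suc m j | sign-suc j =
    solve 4 (λ b s x y → b :* (s :* x :+ (:- s) :* y) := s :* b :* x :- s :* b :* y) refl
            (binom p j) (sign j) (1/ (m ℕ.+ j ℕ.+ 1)) (1/ (suc m ℕ.+ j ℕ.+ 1))

betaSum-closed : ∀ p m → betaSum p m ≡ toℚ (fact p ℕ.* fact m) * 1/ fact (suc (p ℕ.+ m))
betaSum-closed zero    m = begin
  1ℚ * 1ℚ * 1/ (m ℕ.+ 0 ℕ.+ 1) + 0ℚ        ≡⟨ solve 1 (λ x → con 1ℚ :* con 1ℚ :* x :+ con 0ℚ := con 1ℚ :* x) refl (1/ (m ℕ.+ 0 ℕ.+ 1)) ⟩
  toℚ 1 * 1/ (m ℕ.+ 0 ℕ.+ 1)               ≡⟨ fraction-cong 1 (m ℕ.+ 0 ℕ.+ 1) (1 ℕ.* fact m) (fact (suc m))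
                                                 (ℕₚ.m+1+n≢0 (m ℕ.+ 0)) (fact≢0 (suc m)) (cross-multiplied m (fact m)) ⟩
  toℚ (1 ℕ.* fact m) * 1/ fact (suc m)     ∎
  where
  open ≡-Reasoning
  cross-multiplied : ∀ m f → 1 ℕ.* ((1 ℕ.+ m) ℕ.* f) ≡ 1 ℕ.* f ℕ.* (m ℕ.+ 0 ℕ.+ 1)
  cross-multiplied = solve-∀
betaSum-closed (suc p) m = begin
  betaSum (suc p) m
    ≡⟨ betaSum-suc p m ⟩
  betaSum p m - betaSum p (suc m)
    ≡⟨ cong₂ _-_ (betaSum-closed p m) (trans (betaSum-closed p (suc m))
                                             (cong (λ k → toℚ (fp ℕ.* fact (suc m)) * 1/ fact (suc k)) (ℕₚ.+-suc p m))) ⟩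
  toℚ (fp ℕ.* fm) * 1/ fact K - toℚ (fp ℕ.* fact (suc m)) * 1/ fact (suc K)
    ≡⟨ cong (_- toℚ (fp ℕ.* fact (suc m)) * 1/ fact (suc K))
         (fraction-cong (fp ℕ.* fm) (fact K) (fp ℕ.* fm ℕ.* suc K) (fact (suc K)) (fact≢0 K) (fact≢0 (suc K))
                        (raise (fp ℕ.* fm) K (fact K))) ⟩
  toℚ (fp ℕ.* fm ℕ.* suc K) * 1/ fact (suc K) - toℚ (fp ℕ.* fact (suc m)) * 1/ fact (suc K)
    ≡⟨ cong (λ z → toℚ z * 1/ fact (suc K) - toℚ (fp ℕ.* fact (suc m)) * 1/ fact (suc K))
            (trans (expand fp fm m p) (ℕₚ.+-comm (fp ℕ.* fact (suc m)) (fact (suc p) ℕ.* fm))) ⟩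
  toℚ (fact (suc p) ℕ.* fm ℕ.+ fp ℕ.* fact (suc m)) * 1/ fact (suc K) - toℚ (fp ℕ.* fact (suc m)) * 1/ fact (suc K)
    ≡⟨ cong (λ z → z * 1/ fact (suc K) - toℚ (fp ℕ.* fact (suc m)) * 1/ fact (suc K))
            (toℚ-+ (fact (suc p) ℕ.* fm) (fp ℕ.* fact (suc m))) ⟩
  (toℚ (fact (suc p) ℕ.* fm) + toℚ (fp ℕ.* fact (suc m))) * 1/ fact (suc K) - toℚ (fp ℕ.* fact (suc m)) * 1/ fact (suc K)
    ≡⟨ solve 3 (λ z y i → (z :+ y) :* i :- y :* i := z :* i) refl
               (toℚ (fact (suc p) ℕ.* fm)) (toℚ (fp ℕ.* fact (suc m))) (1/ fact (suc K)) ⟩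
  toℚ (fact (suc p) ℕ.* fm) * 1/ fact (suc K)
    ∎
  where
  open ≡-Reasoning
  fp fm K : ℕ
  fp = fact p
  fm = fact m
  K  = suc (p ℕ.+ m)
  raise : ∀ a k f → a ℕ.* ((1 ℕ.+ k) ℕ.* f) ≡ a ℕ.* (1 ℕ.+ k) ℕ.* f
  raise = solve-∀
  expand : ∀ a b m p → a ℕ.* b ℕ.* (2 ℕ.+ (p ℕ.+ m)) ≡ a ℕ.* ((1 ℕ.+ m) ℕ.* b) ℕ.+ (1 ℕ.+ p) ℕ.* a ℕ.* b
  expand = solve-∀

1/fact*betaSum : ∀ p m → 1/ fact p * betaSum p m ≡ toℚ (fact m) * 1/ fact (suc (p ℕ.+ m))
1/fact*betaSum p m = begin
  1/ fact p * betaSum p m                                 ≡⟨ cong (1/ fact p *_) (trans (betaSum-closed p m)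
                                                               (cong (_* 1/ fact (suc (p ℕ.+ m))) (toℚ-* (fact p) (fact m)))) ⟩
  1/ fact p * (toℚ (fact p) * toℚ (fact m) * I)           ≡⟨ solve 4 (λ a b c d → a :* (b :* c :* d) := b :* a :* (c :* d)) refl
                                                               (1/ fact p) (toℚ (fact p)) (toℚ (fact m)) I ⟩
  toℚ (fact p) * 1/ fact p * (toℚ (fact m) * I)           ≡⟨ cong (_* (toℚ (fact m) * I)) (toℚ*1/-cancel (fact p) (fact≢0 p)) ⟩
  1ℚ * (toℚ (fact m) * I)                                 ≡⟨ ℚₚ.*-identityˡ _ ⟩
  toℚ (fact m) * I                                        ∎
  where
  open ≡-Reasoning
  I : ℚ
  I = 1/ fact (suc (p ℕ.+ m))

-- The left-hand side

-- The paper's n is N = p + 1, and A i is its bracket.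
module LeftHandSide (p m : ℕ) where

  N : ℕ
  N = suc p

  E : ℕ → ℕ
  E j = m ℕ.+ j ℕ.+ 1

  term : ℕ → ℕ → ℚ
  term i j = binom p j * (- toℚ i) ^ (p ∸ j) * ((toℚ N ^ E j - toℚ i ^ E j) * 1/ E j)

  A : ℕ → ℚ
  A i = ∑ (suc p) (term i)

  A-zero : A 0 ≡ toℚ N ^ (m ℕ.+ N) * 1/ (m ℕ.+ N)
  A-zero = begin
    A 0                                        ≡⟨ ∑-init-last p (term 0) ⟩
    ∑ p (term 0) + term 0 p                    ≡⟨ cong₂ _+_ (∑-zero p (λ j j<p → lower-vanishes j j<p)) top ⟩
    0ℚ + toℚ N ^ (m ℕ.+ N) * 1/ (m ℕ.+ N)      ≡⟨ ℚₚ.+-identityˡ _ ⟩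
    toℚ N ^ (m ℕ.+ N) * 1/ (m ℕ.+ N)           ∎
    where
    open ≡-Reasoning
    lower-vanishes : ∀ j → j < p → term 0 j ≡ 0ℚ
    lower-vanishes j j<p = begin
      binom p j * (- toℚ 0) ^ (p ∸ j) * R                ≡⟨ cong (λ e → binom p j * (- toℚ 0) ^ e * R) (ℕₚ.+-∸-assoc 1 j<p) ⟩
      binom p j * (0ℚ * (- toℚ 0) ^ (p ∸ suc j)) * R     ≡⟨ cong (λ z → binom p j * z * R) (ℚₚ.*-zeroˡ ((- toℚ 0) ^ (p ∸ suc j))) ⟩
      binom p j * 0ℚ * R                                 ≡⟨ cong (_* R) (ℚₚ.*-zeroʳ (binom p j)) ⟩
      0ℚ * R                                             ≡⟨ ℚₚ.*-zeroˡ R ⟩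
      0ℚ                                                 ∎
      where
      R : ℚ
      R = (toℚ N ^ E j - toℚ 0 ^ E j) * 1/ E j
    Ep≡m+N : E p ≡ m ℕ.+ N
    Ep≡m+N = trans (ℕₚ.+-assoc m p 1) (cong (m ℕ.+_) (ℕₚ.+-comm p 1))
    top : term 0 p ≡ toℚ N ^ (m ℕ.+ N) * 1/ (m ℕ.+ N)
    top = begin
      binom p p * (- toℚ 0) ^ (p ∸ p) * ((toℚ N ^ E p - toℚ 0 ^ E p) * 1/ E p)
        ≡⟨ cong₂ (λ b e → b * (- toℚ 0) ^ e * ((toℚ N ^ E p - toℚ 0 ^ E p) * 1/ E p)) (binom-diag p) (ℕₚ.n∸n≡0 p) ⟩
      1ℚ * 1ℚ * ((toℚ N ^ E p - toℚ 0 ^ E p) * 1/ E p)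
        ≡⟨ cong (λ e → 1ℚ * 1ℚ * ((toℚ N ^ e - toℚ 0 ^ e) * 1/ e)) Ep≡m+N ⟩
      1ℚ * 1ℚ * ((toℚ N ^ (m ℕ.+ N) - toℚ 0 ^ (m ℕ.+ N)) * 1/ (m ℕ.+ N))
        ≡⟨ cong (λ z → 1ℚ * 1ℚ * ((toℚ N ^ (m ℕ.+ N) - z) * 1/ (m ℕ.+ N)))
                (trans (cong (toℚ 0 ^_) (ℕₚ.+-suc m p)) (ℚₚ.*-zeroˡ (toℚ 0 ^ (m ℕ.+ p)))) ⟩
      1ℚ * 1ℚ * ((toℚ N ^ (m ℕ.+ N) - 0ℚ) * 1/ (m ℕ.+ N))
        ≡⟨ solve 2 (λ x y → con 1ℚ :* con 1ℚ :* ((x :- con 0ℚ) :* y) := x :* y) refl (toℚ N ^ (m ℕ.+ N)) (1/ (m ℕ.+ N)) ⟩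
      toℚ N ^ (m ℕ.+ N) * 1/ (m ℕ.+ N)
        ∎

  inner-sum≡A : ∀ i → Σ[ 0 to p ] (λ j → binom p j * ((ℤ.- (ℤ.+ i)) ℤ.^ (N ∸ j ∸ 1) // 1)
                         * ((ℤ.+ (N ℕ.^ E j) ℤ.- ℤ.+ (i ℕ.^ E j)) // E j)) ≡ A i
  inner-sum≡A i = trans (Σ-to≡∑ 0 p summand) (∑-cong (suc p) (λ j _ → cong₂ (λ u v → binom p j * u * v) (power j) (difference j)))
    where
    summand : ℕ → ℚ
    summand j = binom p j * ((ℤ.- (ℤ.+ i)) ℤ.^ (N ∸ j ∸ 1) // 1) * ((ℤ.+ (N ℕ.^ E j) ℤ.- ℤ.+ (i ℕ.^ E j)) // E j)
    power : ∀ j → (ℤ.- (ℤ.+ i)) ℤ.^ (N ∸ j ∸ 1) // 1 ≡ (- toℚ i) ^ (p ∸ j)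
    power j = begin
      (ℤ.- (ℤ.+ i)) ℤ.^ (N ∸ j ∸ 1) // 1   ≡⟨ cong (λ e → (ℤ.- (ℤ.+ i)) ℤ.^ e // 1) (trans (ℕₚ.∸-+-assoc N j 1) (cong (N ∸_) (ℕₚ.+-comm j 1))) ⟩
      (ℤ.- (ℤ.+ i)) ℤ.^ (p ∸ j) // 1       ≡⟨ //1-^ (ℤ.- (ℤ.+ i)) (p ∸ j) ⟩
      ((ℤ.- (ℤ.+ i)) // 1) ^ (p ∸ j)       ≡⟨ cong (_^ (p ∸ j)) (//1-neg (ℤ.+ i)) ⟩
      (- toℚ i) ^ (p ∸ j)                  ∎
      where open ≡-Reasoning
    difference : ∀ j → (ℤ.+ (N ℕ.^ E j) ℤ.- ℤ.+ (i ℕ.^ E j)) // E j ≡ (toℚ N ^ E j - toℚ i ^ E j) * 1/ E j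
    difference j = begin
      (x ℤ.- y) // E j                        ≡⟨ //≡*1/ (x ℤ.- y) (E j) ⟩
      (x ℤ.- y) // 1 * 1/ E j                 ≡⟨ cong (_* 1/ E j) (//1-+ x (ℤ.- y)) ⟨
      (x // 1 + (ℤ.- y) // 1) * 1/ E j        ≡⟨ cong (λ z → (x // 1 + z) * 1/ E j) (//1-neg y) ⟩
      (toℚ (N ℕ.^ E j) - toℚ (i ℕ.^ E j)) * 1/ E j
                                              ≡⟨ cong₂ (λ u v → (u - v) * 1/ E j) (toℚ-^ N (E j)) (toℚ-^ i (E j)) ⟩
      (toℚ N ^ E j - toℚ i ^ E j) * 1/ E j    ∎
      where
      open ≡-Reasoning
      x y : ℤ
      x = ℤ.+ (N ℕ.^ E j)
      y = ℤ.+ (i ℕ.^ E j)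

  lhs≡1/fact*alternatingSum : lhs N m ≡ 1/ fact p * alternatingSum N A
  lhs≡1/fact*alternatingSum = cong (1/ fact p *_) (cong₂ _+_ leading alternating)
    where
    leading : ℤ.+ (N ℕ.^ (m ℕ.+ N)) // (m ℕ.+ N) ≡ 1ℚ * 1ℚ * A 0
    leading = begin
      ℤ.+ (N ℕ.^ (m ℕ.+ N)) // (m ℕ.+ N)   ≡⟨ //≡*1/ (ℤ.+ (N ℕ.^ (m ℕ.+ N))) (m ℕ.+ N) ⟩
      toℚ (N ℕ.^ (m ℕ.+ N)) * 1/ (m ℕ.+ N) ≡⟨ cong (_* 1/ (m ℕ.+ N)) (toℚ-^ N (m ℕ.+ N)) ⟩
      toℚ N ^ (m ℕ.+ N) * 1/ (m ℕ.+ N)     ≡⟨ A-zero ⟨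
      A 0                                  ≡⟨ solve 1 (λ x → x := con 1ℚ :* con 1ℚ :* x) refl (A 0) ⟩
      1ℚ * 1ℚ * A 0                        ∎
      where open ≡-Reasoning
    outer : ℕ → ℚ
    outer i = (ℤ.- ℤ.+ 1) ℤ.^ i // 1 * binom N i * Σ[ 0 to p ] (λ j → binom p j * ((ℤ.- (ℤ.+ i)) ℤ.^ (N ∸ j ∸ 1) // 1)
                                                           * ((ℤ.+ (N ℕ.^ E j) ℤ.- ℤ.+ (i ℕ.^ E j)) // E j))
    alternating : Σ[ 1 to N ] outer ≡ ∑[ k < N ] (sign (suc k) * binom N (suc k) * A (suc k))
    alternating = trans (Σ-to≡∑ 1 N outer) (∑-cong N (λ k _ → cong₂ (λ s t → s * binom N (suc k) * t)
      (trans (//1-^ (ℤ.- ℤ.+ 1) (suc k)) (cong (_^ suc k) (//1-neg (ℤ.+ 1))))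
      (inner-sum≡A (suc k))))

  b : ℕ → ℚ
  b j = binom p j * sign (p ∸ j) * 1/ E j

  a : ℕ → ℚ
  a j = b j * toℚ N ^ E j

  p∸j+Ej≡m+N : ∀ {j} → j ≤ p → (p ∸ j) ℕ.+ E j ≡ m ℕ.+ N
  p∸j+Ej≡m+N {j} j≤p = trans (shuffle (p ∸ j) m j) (cong (λ t → m ℕ.+ suc t) (ℕₚ.m∸n+n≡m j≤p))
    where
    shuffle : ∀ d m j → d ℕ.+ (m ℕ.+ j ℕ.+ 1) ≡ m ℕ.+ suc (d ℕ.+ j)
    shuffle = solve-∀

  term-split : ∀ i {j} → j ≤ p → term i j ≡ a j * toℚ i ^ (p ∸ j) - b j * toℚ i ^ (m ℕ.+ N)
  term-split i {j} j≤p = begin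
    binom p j * (- x) ^ (p ∸ j) * ((Y - x ^ E j) * 1/ E j)
      ≡⟨ cong (λ z → binom p j * z * ((Y - x ^ E j) * 1/ E j)) (^-neg x (p ∸ j)) ⟩
    binom p j * (sign (p ∸ j) * x ^ (p ∸ j)) * ((Y - x ^ E j) * 1/ E j)
      ≡⟨ solve 6 (λ c s d y e i → c :* (s :* d) :* ((y :- e) :* i) := c :* s :* i :* y :* d :- c :* s :* i :* (d :* e)) refl
                 (binom p j) (sign (p ∸ j)) (x ^ (p ∸ j)) Y (x ^ E j) (1/ E j) ⟩
    b j * Y * x ^ (p ∸ j) - b j * (x ^ (p ∸ j) * x ^ E j)
      ≡⟨ cong (λ z → b j * Y * x ^ (p ∸ j) - b j * z)
              (trans (sym (^-homo-* x (p ∸ j) (E j))) (cong (x ^_) (p∸j+Ej≡m+N j≤p))) ⟩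
    b j * Y * x ^ (p ∸ j) - b j * x ^ (m ℕ.+ N)
      ∎
    where
    open ≡-Reasoning
    x Y : ℚ
    x = toℚ i
    Y = toℚ N ^ E j

  A-split : ∀ i → A i ≡ ∑[ j < suc p ] (a j * toℚ i ^ (p ∸ j)) - ∑ (suc p) b * toℚ i ^ (m ℕ.+ N)
  A-split i = begin
    A i
      ≡⟨ ∑-cong (suc p) (λ j j≤p → term-split i (ℕₚ.≤-pred j≤p)) ⟩
    ∑[ j < suc p ] (a j * toℚ i ^ (p ∸ j) - b j * toℚ i ^ (m ℕ.+ N))
      ≡⟨ ∑-distrib-sub (suc p) (λ j → a j * toℚ i ^ (p ∸ j)) (λ j → b j * toℚ i ^ (m ℕ.+ N)) ⟩
    ∑[ j < suc p ] (a j * toℚ i ^ (p ∸ j)) - ∑[ j < suc p ] (b j * toℚ i ^ (m ℕ.+ N))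
      ≡⟨ cong (_-_ (∑[ j < suc p ] (a j * toℚ i ^ (p ∸ j)))) (*-distribʳ-∑ (suc p) (toℚ i ^ (m ℕ.+ N)) b) ⟨
    ∑[ j < suc p ] (a j * toℚ i ^ (p ∸ j)) - ∑ (suc p) b * toℚ i ^ (m ℕ.+ N)
      ∎
    where open ≡-Reasoning

  ∑b≡sign*betaSum : ∑ (suc p) b ≡ sign p * betaSum p m
  ∑b≡sign*betaSum = trans (∑-cong (suc p) (λ j j≤p → resign j (ℕₚ.≤-pred j≤p)))
                          (sym (*-distribˡ-∑ (suc p) (sign p) (λ j → sign j * binom p j * 1/ E j)))
    where
    resign : ∀ j → j ≤ p → b j ≡ sign p * (sign j * binom p j * 1/ E j)
    resign j j≤p = trans (cong (λ s → binom p j * s * 1/ E j) (sign-∸ j≤p))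
      (solve 4 (λ c s t i → c :* (s :* t) :* i := s :* (t :* c :* i)) refl (binom p j) (sign p) (sign j) (1/ E j))

  -- Each i ↦ iᵖ⁻ʲ is a polynomial of degree < N, which the N-th difference annihilates.
  alternatingSum-lower-powers : alternatingSum N (λ i → ∑[ j < suc p ] (a j * toℚ i ^ (p ∸ j))) ≡ 0ℚ
  alternatingSum-lower-powers = trans (alternatingSum-∑ N (suc p) (λ j i → a j * toℚ i ^ (p ∸ j)))
    (∑-zero (suc p) (λ j _ → begin
      alternatingSum N (λ i → a j * toℚ i ^ (p ∸ j))   ≡⟨ alternatingSum-*ˡ N (a j) (λ i → toℚ i ^ (p ∸ j)) ⟩
      a j * alternatingSum N (λ i → toℚ i ^ (p ∸ j))   ≡⟨ cong (a j *_) (alternatingSum-power-< (s≤s (ℕₚ.m∸n≤m p j))) ⟩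
      a j * 0ℚ                                         ≡⟨ ℚₚ.*-zeroʳ (a j) ⟩
      0ℚ                                               ∎))
    where open ≡-Reasoning

  alternatingSum-A : alternatingSum N A ≡ surjections N (m ℕ.+ N) * betaSum p m
  alternatingSum-A = begin
    alternatingSum N A
      ≡⟨ alternatingSum-cong N A-split ⟩
    alternatingSum N (λ i → ∑[ j < suc p ] (a j * toℚ i ^ (p ∸ j)) - c * toℚ i ^ (m ℕ.+ N))
      ≡⟨ alternatingSum-sub N (λ i → ∑[ j < suc p ] (a j * toℚ i ^ (p ∸ j))) (λ i → c * toℚ i ^ (m ℕ.+ N)) ⟩
    alternatingSum N (λ i → ∑[ j < suc p ] (a j * toℚ i ^ (p ∸ j))) - alternatingSum N (λ i → c * toℚ i ^ (m ℕ.+ N))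
      ≡⟨ cong₂ _-_ alternatingSum-lower-powers (alternatingSum-*ˡ N c (λ i → toℚ i ^ (m ℕ.+ N))) ⟩
    0ℚ - c * alternatingSum N (λ i → toℚ i ^ (m ℕ.+ N))
      ≡⟨ cong₂ (λ x y → 0ℚ - x * y) ∑b≡sign*betaSum (alternatingSum≡sign*Δ N (λ i → toℚ i ^ (m ℕ.+ N))) ⟩
    0ℚ - sign p * betaSum p m * (sign N * surjections N (m ℕ.+ N))
      ≡⟨ cong (λ s → 0ℚ - sign p * betaSum p m * (s * surjections N (m ℕ.+ N))) (sign-suc p) ⟩
    0ℚ - sign p * betaSum p m * (- sign p * surjections N (m ℕ.+ N))
      ≡⟨ solve 3 (λ s β σ → con 0ℚ :- s :* β :* (:- s :* σ) := σ :* β :* (s :* s)) refl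
                 (sign p) (betaSum p m) (surjections N (m ℕ.+ N)) ⟩
    surjections N (m ℕ.+ N) * betaSum p m * (sign p * sign p)
      ≡⟨ trans (cong (surjections N (m ℕ.+ N) * betaSum p m *_) (sign*sign p)) (ℚₚ.*-identityʳ _) ⟩
    surjections N (m ℕ.+ N) * betaSum p m
      ∎
    where
    open ≡-Reasoning
    c : ℚ
    c = ∑ (suc p) b

lemma4p2 : (n m : ℕ) → n ≥ 1 → m ≥ 1 → lhs n m ≡ rhs n m
lemma4p2 (suc p) m _ _ = begin
  lhs N m                                                      ≡⟨ lhs≡1/fact*alternatingSum ⟩
  1/ fact p * alternatingSum N A                               ≡⟨ cong (1/ fact p *_) alternatingSum-A ⟩
  1/ fact p * (surjections N (m ℕ.+ N) * betaSum p m)          ≡⟨ solve 3 (λ f s β → f :* (s :* β) := s :* (f :* β)) refl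
                                                                    (1/ fact p) (surjections N (m ℕ.+ N)) (betaSum p m) ⟩
  surjections N (m ℕ.+ N) * (1/ fact p * betaSum p m)          ≡⟨ cong₂ (λ k β → surjections N k * β) (ℕₚ.+-comm m N) (1/fact*betaSum p m) ⟩
  surjections N (N ℕ.+ m) * (toℚ (fact m) * 1/ fact (N ℕ.+ m)) ≡⟨ solve 3 (λ s f i → s :* (f :* i) := f :* (s :* i)) refl
                                                                    (surjections N (N ℕ.+ m)) (toℚ (fact m)) (1/ fact (N ℕ.+ m)) ⟩
  toℚ (fact m) * (surjections N (N ℕ.+ m) * 1/ fact (N ℕ.+ m)) ≡⟨ cong (toℚ (fact m) *_) (compositionWeight-closed N ℕₚ.≤-refl) ⟨
  toℚ (fact m) * compositionWeight N m m                       ≡⟨ rhs≡fact*compositionWeight N m ⟨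
  rhs N m                                                      ∎
  where
  open LeftHandSide p m
  open ≡-Reasoning
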